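{- For every positive integer $n$, $C(4n)=C(2n)+1$.
   Context: Let $\phi$ be Euler's totient function and $g(n)=n-\phi(n)$ for $n\geq 1$ (the move map of the game \textsc{nontotient}); write $g^i$ for the $i$-fold iterate. For $n\geq 1$, $C(n)$ denotes the least $i\geq 0$ with $g^i(n)=1$. -}

module Defs where

open import Data.Nat using (ℕ; zero; suc; _∸_; _<_)
open import Data.Nat.GCD using (gcd)
open import Data.List using (List; filter; length)
open import Data.List using (upTo; map)
open import Data.Nat using (_≟_)
open import Data.Product using (_×_)
open import Relation.Binary.PropositionalEquality using (_≡_)
open import Relation.Nullary using (¬_)
open import Function using (_∘_)

-- Euler's totient: φ(n) = #{ k : 1 ≤ k ≤ n , gcd(k,n) = 1 }  (so φ(1) = 1, φ(0) = 0)
φ : ℕ → ℕ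
φ n = length (filter (λ k → gcd k n ≟ 1) (map suc (upTo n)))

g : ℕ → ℕ
g n = n ∸ φ n

iter : ℕ → ℕ → ℕ
iter zero    n = n
iter (suc i) n = g (iter i n)

IsC : ℕ → ℕ → Set
IsC n i = (iter i n ≡ 1) × (∀ j → j < i → ¬ (iter j n ≡ 1))

-- For even x the residues coprime to 2x are those coprime to x, met twice in [1, 2x], so
-- φ(2x) = 2φ(x) and g(2x) = 2g(x). For n ≥ 3 the involution k ↦ n − k of [1, n − 1] preserves
-- coprimality to n and has no coprime fixed point, so φ(n) is even. Hence g sends an even x ≥ 4
-- to a smaller positive even number, and along the orbit of x the orbit of 2x stays at twice it;
-- strong induction on x from C(2) = 1, C(4) = 2 gives C(2x) = C(x) + 1.
module Submission where

open import Defs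
open import Data.Nat using (ℕ; zero; suc; _*_; _+_; _∸_; _≤_; _<_; z≤n; s≤s; z<s; _≟_)
open import Data.Nat.Properties
open import Data.Nat.Divisibility
open import Data.Nat.GCD using (gcd)
open import Data.Nat.Coprimality
  using (Coprime; coprime⇒gcd≡1; gcd≡1⇒coprime; coprime?; coprime-+; coprime-divisor; 1-coprimeTo)
open import Data.Nat.Induction using (<-rec)
open import Data.List using ([]; _∷_; filter; length; upTo; map; _++_)
open import Data.List.Properties
  using (applyUpTo-∷ʳ; map-++; filter-++; length-++; filter-accept; filter-reject)
open import Data.Product using (∃; _×_; _,_)
open import Function using (_∘_; _⇔_; mk⇔; Equivalence)
open import Function.Construct.Composition using (_⇔-∘_)
open import Relation.Binary.PropositionalEquality
open import Relation.Nullary using (¬_; yes; no; contradiction)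

∑ : (ℕ → ℕ) → ℕ → ℕ
∑ h zero    = 0
∑ h (suc m) = ∑ h m + h (suc m)

∑-cong : ∀ {h₁ h₂} m → (∀ k → k < m → h₁ (suc k) ≡ h₂ (suc k)) → ∑ h₁ m ≡ ∑ h₂ m
∑-cong zero    eq = refl
∑-cong (suc m) eq = cong₂ _+_ (∑-cong m (λ k k<m → eq k (m<n⇒m<1+n k<m))) (eq m (n<1+n m))

∑-+ : ∀ h a b → ∑ h (a + b) ≡ ∑ h a + ∑ (λ j → h (a + j)) b
∑-+ h a zero    rewrite +-identityʳ a = sym (+-identityʳ (∑ h a))
∑-+ h a (suc b) rewrite +-suc a b | ∑-+ h a b =
  +-assoc (∑ h a) (∑ (λ j → h (a + j)) b) (h (suc (a + b)))

∑-≤ : ∀ h m → (∀ k → h k ≤ 1) → ∑ h m ≤ m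
∑-≤ h zero    h≤1 = z≤n
∑-≤ h (suc m) h≤1 =
  subst (∑ h m + h (suc m) ≤_) (+-comm m 1) (+-mono-≤ (∑-≤ h m h≤1) (h≤1 (suc m)))

2*n≡n+n : ∀ n → 2 * n ≡ n + n
2*n≡n+n n = cong (n +_) (+-identityʳ n)

2∣n+n : ∀ n → 2 ∣ n + n
2∣n+n n = divides n (trans (sym (2*n≡n+n n)) (*-comm 2 n))

∣m∣n⇒∣m∸n : ∀ {d m n} → d ∣ m → d ∣ n → d ∣ m ∸ n
∣m∣n⇒∣m∸n {d} (divides-refl p) (divides-refl q) = divides (p ∸ q) (sym (*-distribʳ-∸ d p q))

∑-palindrome-even : ∀ m h → (∀ j → j < m → h (suc j) ≡ h (m ∸ j)) →
                    (∀ k → k + k ≡ suc m → h k ≡ 0) → 2 ∣ ∑ h m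
∑-palindrome-even zero          h pal mid = 2 ∣0
∑-palindrome-even (suc zero)    h pal mid = divides 0 (mid 1 refl)
∑-palindrome-even (suc (suc m)) h pal mid =
  subst (2 ∣_) (sym peel) (∣m∣n⇒∣m+n (2∣n+n (h 1)) (∑-palindrome-even m (h ∘ suc) pal′ mid′))
  where
  open ≡-Reasoning
  pal′ : ∀ j → j < m → h (suc (suc j)) ≡ h (suc (m ∸ j))
  pal′ j j<m = trans (pal (suc j) (s≤s (m<n⇒m<1+n j<m))) (cong h (+-∸-assoc 1 (<⇒≤ j<m)))
  mid′ : ∀ k → k + k ≡ suc m → h (suc k) ≡ 0
  mid′ k k+k≡1+m = mid (suc k) (cong suc (trans (+-suc k k) (cong suc k+k≡1+m)))
  peel : ∑ h (suc (suc m)) ≡ (h 1 + h 1) + ∑ (h ∘ suc) m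
  peel = begin
    ∑ h (1 + m) + h (2 + m)           ≡⟨ cong₂ _+_ (∑-+ h 1 m) (sym (pal 0 z<s)) ⟩
    (h 1 + ∑ (h ∘ suc) m) + h 1       ≡⟨ +-assoc (h 1) _ (h 1) ⟩
    h 1 + (∑ (h ∘ suc) m + h 1)       ≡⟨ cong (h 1 +_) (+-comm _ (h 1)) ⟩
    h 1 + (h 1 + ∑ (h ∘ suc) m)       ≡⟨ +-assoc (h 1) (h 1) _ ⟨
    (h 1 + h 1) + ∑ (h ∘ suc) m       ∎

coprime-antitone : ∀ {a n b m} → (∀ {d} → d ∣ a × d ∣ n → d ∣ b × d ∣ m) →
                   Coprime b m → Coprime a n
coprime-antitone f c = c ∘ f

coprime-* : ∀ {k m n} → Coprime k m → Coprime k n → Coprime k (m * n)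
coprime-* {k} {m} {n} k⊥m k⊥n (d∣k , d∣mn) = k⊥n (d∣k , coprime-divisor d⊥m d∣mn)
  where
  d⊥m = coprime-antitone (λ (e∣d , e∣m) → ∣-trans e∣d d∣k , e∣m) k⊥m

coprime-2*⇔ : ∀ {k x} → 2 ∣ x → Coprime k (2 * x) ⇔ Coprime k x
coprime-2*⇔ {k} {x} 2∣x = mk⇔
  (coprime-antitone (λ (d∣k , d∣x) → d∣k , ∣n⇒∣m*n 2 d∣x))
  (λ k⊥x → coprime-* (coprime-antitone (λ (d∣k , d∣2) → d∣k , ∣-trans d∣2 2∣x) k⊥x) k⊥x)

coprime-+ˡ⇔ : ∀ {x j} → Coprime (x + j) x ⇔ Coprime j x
coprime-+ˡ⇔ = mk⇔ (coprime-antitone (λ (d∣j , d∣x) → ∣m∣n⇒∣m+n d∣x d∣j , d∣x)) coprime-+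

coprime-complement : ∀ {a b n} → a + b ≡ n → Coprime a n → Coprime b n
coprime-complement {a} {b} refl = coprime-antitone λ {d} (d∣b , d∣n) →
  ∣m+n∣m⇒∣n (subst (d ∣_) (+-comm a b) d∣n) d∣b , d∣n

divisor-¬coprime : ∀ {d n} → d ∣ n → d ≢ 1 → ¬ Coprime d n
divisor-¬coprime d∣n d≢1 d⊥n = d≢1 (d⊥n (∣-refl , d∣n))

χ : ℕ → ℕ → ℕ
χ n k = length (filter (λ i → gcd i n ≟ 1) (k ∷ []))

φ≡∑χ : ∀ n → φ n ≡ ∑ (χ n) n
φ≡∑χ n = go n
  where
  open ≡-Reasoning
  P = λ k → gcd k n ≟ 1
  go : ∀ m → length (filter P (map suc (upTo m))) ≡ ∑ (χ n) m
  go zero    = refl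
  go (suc m) = begin
    length (filter P (map suc (upTo (suc m))))
      ≡⟨ cong (λ l → length (filter P (map suc l))) (applyUpTo-∷ʳ (λ i → i) m) ⟨
    length (filter P (map suc (upTo m ++ m ∷ [])))
      ≡⟨ cong (λ l → length (filter P l)) (map-++ suc (upTo m) (m ∷ [])) ⟩
    length (filter P (map suc (upTo m) ++ suc m ∷ []))
      ≡⟨ cong length (filter-++ P (map suc (upTo m)) (suc m ∷ [])) ⟩
    length (filter P (map suc (upTo m)) ++ filter P (suc m ∷ []))
      ≡⟨ length-++ (filter P (map suc (upTo m))) ⟩
    length (filter P (map suc (upTo m))) + χ n (suc m)
      ≡⟨ cong (_+ χ n (suc m)) (go m) ⟩
    ∑ (χ n) m + χ n (suc m)
      ∎

χ-coprime : ∀ {n k} → Coprime k n → χ n k ≡ 1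
χ-coprime {n} {k} k⊥n =
  cong length (filter-accept (λ i → gcd i n ≟ 1) {x = k} {xs = []} (coprime⇒gcd≡1 k⊥n))

χ-¬coprime : ∀ {n k} → ¬ Coprime k n → χ n k ≡ 0
χ-¬coprime {n} {k} k⊥̸n =
  cong length (filter-reject (λ i → gcd i n ≟ 1) {x = k} {xs = []} (k⊥̸n ∘ gcd≡1⇒coprime))

χ≤1 : ∀ n k → χ n k ≤ 1
χ≤1 n k with coprime? k n
... | yes k⊥n = ≤-reflexive (χ-coprime k⊥n)
... | no  k⊥̸n = ≤-trans (≤-reflexive (χ-¬coprime k⊥̸n)) z≤n

χ-cong : ∀ {n a m b} → Coprime a n ⇔ Coprime b m → χ n a ≡ χ m b
χ-cong {n} {a} a⊥n⇔b⊥m with coprime? a n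
... | yes a⊥n = trans (χ-coprime a⊥n) (sym (χ-coprime (Equivalence.to a⊥n⇔b⊥m a⊥n)))
... | no  a⊥̸n = trans (χ-¬coprime a⊥̸n) (sym (χ-¬coprime (a⊥̸n ∘ Equivalence.from a⊥n⇔b⊥m)))

χ-self : ∀ k → χ (2 + k) (2 + k) ≡ 0
χ-self k = χ-¬coprime (divisor-¬coprime {2 + k} ∣-refl λ ())

φ≤n : ∀ n → φ n ≤ n
φ≤n n = subst (_≤ n) (sym (φ≡∑χ n)) (∑-≤ (χ n) n (χ≤1 n))

φ-positive : ∀ n → 0 < φ (suc n)
φ-positive n = begin-strict
  0                                    <⟨ z<s ⟩
  1                                    ≡⟨ χ-coprime (1-coprimeTo (suc n)) ⟨
  χ (suc n) 1                          ≤⟨ m≤m+n _ _ ⟩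
  χ (suc n) 1 + ∑ (χ (suc n) ∘ suc) n  ≡⟨ ∑-+ (χ (suc n)) 1 n ⟨
  ∑ (χ (suc n)) (suc n)                ≡⟨ φ≡∑χ (suc n) ⟨
  φ (suc n)                            ∎
  where open ≤-Reasoning

φ<n : ∀ k → φ (2 + k) < 2 + k
φ<n k = begin-strict
  φ (2 + k)                ≡⟨ φ≡∑χ (2 + k) ⟩
  ∑ h (1 + k) + h (2 + k)  ≡⟨ cong (∑ h (1 + k) +_) (χ-self k) ⟩
  ∑ h (1 + k) + 0          ≡⟨ +-identityʳ _ ⟩
  ∑ h (1 + k)              ≤⟨ ∑-≤ h (1 + k) (χ≤1 (2 + k)) ⟩
  1 + k                    <⟨ n<1+n (1 + k) ⟩
  2 + k                    ∎
  where
  open ≤-Reasoning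
  h = χ (2 + k)

φ-2* : ∀ {x} → 2 ∣ x → φ (2 * x) ≡ 2 * φ x
φ-2* {x} 2∣x = begin
  φ (2 * x)                          ≡⟨ φ≡∑χ (2 * x) ⟩
  ∑ h (2 * x)                        ≡⟨ cong (∑ h) (2*n≡n+n x) ⟩
  ∑ h (x + x)                        ≡⟨ ∑-+ h x x ⟩
  ∑ h x + ∑ (λ j → h (x + j)) x      ≡⟨ cong₂ _+_ (∑-cong x lower) (∑-cong x upper) ⟩
  ∑ (χ x) x + ∑ (χ x) x              ≡⟨ cong₂ _+_ (φ≡∑χ x) (φ≡∑χ x) ⟨
  φ x + φ x                          ≡⟨ 2*n≡n+n (φ x) ⟨
  2 * φ x                            ∎
  where
  open ≡-Reasoning
  h = χ (2 * x)
  lower : ∀ k → k < x → h (suc k) ≡ χ x (suc k)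
  lower k _ = χ-cong {a = suc k} (coprime-2*⇔ 2∣x)
  upper : ∀ k → k < x → h (x + suc k) ≡ χ x (suc k)
  upper k _ = χ-cong {a = x + suc k} (coprime-+ˡ⇔ ⇔-∘ coprime-2*⇔ 2∣x)

φ-even : ∀ k → 2 ∣ φ (3 + k)
φ-even k = subst (2 ∣_) (sym φn≡∑) (∑-palindrome-even (2 + k) (χ n) pal mid)
  where
  n = 3 + k
  φn≡∑ : φ n ≡ ∑ (χ n) (2 + k)
  φn≡∑ = trans (φ≡∑χ n) (trans (cong (∑ (χ n) (2 + k) +_) (χ-self (suc k))) (+-identityʳ _))
  pal : ∀ j → j < 2 + k → χ n (suc j) ≡ χ n (2 + k ∸ j)
  pal j j<2+k = χ-cong {n} {suc j}
    (mk⇔ (coprime-complement (trans (+-comm (suc j) _) sum≡n)) (coprime-complement sum≡n))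
    where
    sum≡n : (2 + k ∸ j) + suc j ≡ n
    sum≡n = trans (+-suc _ j) (cong suc (m∸n+n≡m (<⇒≤ j<2+k)))
  ≢1 : ∀ {i} → i ≡ 1 → i + i ≢ n
  ≢1 refl ()
  mid : ∀ i → i + i ≡ n → χ n i ≡ 0
  mid i i+i≡n = χ-¬coprime {n} {i} (divisor-¬coprime i∣n (λ i≡1 → ≢1 i≡1 i+i≡n))
    where
    i∣n : i ∣ n
    i∣n = divides 2 (trans (sym i+i≡n) (sym (2*n≡n+n i)))

g-2* : ∀ {x} → 2 ∣ x → g (2 * x) ≡ 2 * g x
g-2* {x} 2∣x = trans (cong (2 * x ∸_) (φ-2* 2∣x)) (sym (*-distribˡ-∸ 2 x (φ x)))

g-even : ∀ k → 2 ∣ 3 + k → 2 ∣ g (3 + k)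
g-even k 2∣n = ∣m∣n⇒∣m∸n 2∣n (φ-even k)

g<n : ∀ n → g (suc n) < suc n
g<n n = ∸-monoʳ-< (φ-positive n) (φ≤n (suc n))

g-positive : ∀ k → 0 < g (2 + k)
g-positive k = m<n⇒0<n∸m (φ<n k)

iter-suc : ∀ i n → iter (suc i) n ≡ iter i (g n)
iter-suc zero    n = refl
iter-suc (suc i) n = cong g (iter-suc i n)

IsC-1 : IsC 1 0
IsC-1 = refl , λ _ ()

IsC-g : ∀ {n i} → n ≢ 1 → IsC (g n) i → IsC n (suc i)
IsC-g {n} {i} n≢1 (gⁱgn≡1 , minimal) = trans (iter-suc i n) gⁱgn≡1 , minimal′
  where
  minimal′ : ∀ j → j < suc i → iter j n ≢ 1
  minimal′ zero    _         = n≢1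
  minimal′ (suc j) (s≤s j<i) = minimal j j<i ∘ trans (sym (iter-suc j n))

IsC-2* : ∀ x → 2 ∣ x → 0 < x → ∃ λ i → IsC x i × IsC (2 * x) (suc i)
IsC-2* = <-rec _ step
  where
  step : ∀ x → (∀ {y} → y < x → 2 ∣ y → 0 < y → ∃ λ i → IsC y i × IsC (2 * y) (suc i)) →
         2 ∣ x → 0 < x → ∃ λ i → IsC x i × IsC (2 * x) (suc i)
  step 0 _ _ ()
  step 1 _ 2∣1 _ = contradiction (∣1⇒≡1 2∣1) λ ()
  step 2 _ _ _ = 1 , IsC-g (λ ()) IsC-1 , IsC-g (λ ()) (IsC-g (λ ()) IsC-1)
  step (suc (suc (suc k))) rec 2∣x _
    with i , IsC[gx] , IsC[2gx] ← rec (g<n (2 + k)) (g-even k 2∣x) (g-positive (suc k)) =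
    suc i , IsC-g (λ ()) IsC[gx]
          , IsC-g (λ ()) (subst (λ m → IsC m (suc i)) (sym (g-2* 2∣x)) IsC[2gx])

mainTheorem17 : ∀ (n : ℕ) → ∃ λ i → IsC (2 * suc n) i × IsC (4 * suc n) (suc i)
mainTheorem17 n with i , C₂ₙ , C₄ₙ ← IsC-2* (2 * suc n) (∣m⇒∣m*n (suc n) ∣-refl) z<s =
  i , C₂ₙ , subst (λ m → IsC m (suc i)) (sym (*-assoc 2 2 (suc n))) C₄ₙ
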